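{- Let $l\in\omega$ with $l>0$ and let $X\subset\omega$ with $|X|=2^l$. Then there is a family $\{A_\sigma:\sigma\in 2^{\le l}\}$ of subsets of $X$ such that: (1) for every $m\le l$, $\bigcup_{\sigma\in 2^m}A_\sigma=X$ and $A_\sigma\cap A_\tau=\emptyset$ for distinct $\sigma,\tau\in 2^m$; (2) $|A_\sigma|=2^{l-|\sigma|}$ for every $\sigma\in 2^{\le l}$, and $A_\tau\subset A_\sigma$ whenever $\sigma\subset\tau$ are in $2^{\le l}$; (3) for each $\sigma\in 2^{\le l}$ and all $i,j\in A_\sigma$ with $i\ne j$, $|i-j|>2^{|\sigma|-1}$.
   Context: $2^{\le l}$ denotes the set of finite binary sequences of length at most $l$, $2^m$ the set of those of length exactly $m$, $|\sigma|$ the length of $\sigma$, and $\sigma\subset\tau$ means $\tau$ extends $\sigma$. -}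

module Defs where

open import Data.Nat using (ℕ; zero; suc; _^_; _<_)
open import Data.Bool using (Bool)
open import Data.List using (List; _++_)
open import Data.Product using (∃)
open import Relation.Binary.PropositionalEquality using (_≡_)

BinSeq : Set
BinSeq = List Bool

_⊑_ : BinSeq → BinSeq → Set
σ ⊑ τ = ∃ λ ρ → σ ++ ρ ≡ τ

-- GapExceeds m d  ⇔  d > 2^(m-1) read over the rationals:
-- for m = 0 this is d > 1/2, i.e. d > 0 for natural d.
GapExceeds : ℕ → ℕ → Set
GapExceeds zero    d = 0 < d
GapExceeds (suc k) d = 2 ^ k < d

-- Sort X increasingly, so that consecutive entries differ by at least 1. Keeping only the entries
-- in even (or in odd) positions halves a list of even length and doubles the minimal distance
-- between consecutive entries. A_σ keeps, for each bit of σ in turn, the even or the odd positions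
-- of the sorted list; it thus has 2^(l-|σ|) entries, any two of which are 2^|σ| apart.
module Submission where

open import Defs
open import Data.Nat using (ℕ; _^_; _∸_; _<_; _≤_; ∣_-_∣; zero; suc; _+_; _*_; ⌊_/2⌋; ⌈_/2⌉; s≤s)
open import Data.Nat.Properties
open import Data.Nat.Tactic.RingSolver using (solve-∀)
open import Data.Bool using (Bool; true; false)
open import Data.List using (List; length; []; _∷_; _++_)
open import Data.List.Membership.Propositional using (_∈_; _∉_)
open import Data.List.Relation.Unary.Any using (here; there)
open import Data.List.Relation.Unary.All as All using (All)
open import Data.List.Relation.Unary.AllPairs as AllPairs using (AllPairs; []; _∷_)
open import Data.List.Relation.Unary.Linked as Linked using (Linked; []; [-]; _∷_)
open import Data.List.Relation.Unary.Linked.Properties using (AllPairs⇒Linked; Linked⇒AllPairs)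
open import Data.List.Relation.Unary.Unique.Propositional using (Unique)
open import Data.List.Relation.Binary.Sublist.Propositional using (_⊆_; []; _∷_; _∷ʳ_; ⊆-refl; ⊆-trans)
open import Data.List.Relation.Binary.Sublist.Propositional.Properties using (All-resp-⊆; Any-resp-⊆)
open import Data.List.Relation.Binary.Permutation.Propositional using (↭⇒↭ₛ; ↭-sym)
open import Data.List.Relation.Binary.Permutation.Propositional.Properties using (∈-resp-↭; ↭-length)
open import Data.List.Relation.Binary.Permutation.Setoid.Properties using (Unique-resp-↭)
open import Data.List.Sort ≤-decTotalOrder using (sort; sort-↭; sort-↗)
open import Data.Product using (Σ; ∃; ∃-syntax; _×_; _,_; uncurry)
open import Function using (_∘_)
open import Relation.Nullary using (¬_; contradiction)
open import Relation.Binary.Definitions using (Symmetric)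
open import Relation.Binary.PropositionalEquality
  using (_≡_; _≢_; refl; sym; trans; cong; subst; setoid)

2^[1+n]≡2^n+2^n : ∀ n → 2 ^ suc n ≡ 2 ^ n + 2 ^ n
2^[1+n]≡2^n+2^n n = cong (2 ^ n +_) (+-identityʳ (2 ^ n))

module _ {a} {A : Set a} where

  AllPairs-resp-⊇ : ∀ {r} {R : A → A → Set r} {xs ys} → xs ⊆ ys → AllPairs R ys → AllPairs R xs
  AllPairs-resp-⊇ []         []         = []
  AllPairs-resp-⊇ (_ ∷ʳ p)   (_ ∷ rs)   = AllPairs-resp-⊇ p rs
  AllPairs-resp-⊇ (refl ∷ p) (r ∷ rs)   = All-resp-⊆ p r ∷ AllPairs-resp-⊇ p rs

  AllPairs-sym-∈ : ∀ {r} {R : A → A → Set r} → Symmetric R → ∀ {xs x y} →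
                   AllPairs R xs → x ∈ xs → y ∈ xs → x ≢ y → R x y
  AllPairs-sym-∈ sym-R (_ ∷ _)   (here refl) (here refl) x≢y = contradiction refl x≢y
  AllPairs-sym-∈ sym-R (rs ∷ _)  (here refl) (there q)   _   = All.lookup rs q
  AllPairs-sym-∈ sym-R (rs ∷ _)  (there p)   (here refl) _   = sym-R (All.lookup rs p)
  AllPairs-sym-∈ sym-R (_ ∷ rss) (there p)   (there q)   x≢y = AllPairs-sym-∈ sym-R rss p q x≢y

  everyOther : Bool → List A → List A
  everyOther b     []       = []
  everyOther false (x ∷ xs) = x ∷ everyOther true xs
  everyOther true  (x ∷ xs) = everyOther false xs

  everyOther-⊆ : ∀ b xs → everyOther b xs ⊆ xs
  everyOther-⊆ b     []       = []
  everyOther-⊆ false (x ∷ xs) = refl ∷ everyOther-⊆ true xs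
  everyOther-⊆ true  (x ∷ xs) = x ∷ʳ everyOther-⊆ false xs

  ∈-everyOther : ∀ {x xs} → x ∈ xs → ∃[ b ] x ∈ everyOther b xs
  ∈-everyOther (here refl) = false , here refl
  ∈-everyOther (there p) with ∈-everyOther p
  ... | false , q = true , q
  ... | true  , q = false , there q

  everyOther-disjoint : ∀ {x xs} → Unique xs → x ∈ everyOther false xs → x ∉ everyOther true xs
  everyOther-disjoint {xs = _ ∷ xs} (x∉xs ∷ _) (here refl) q =
    All.lookup x∉xs (Any-resp-⊆ (everyOther-⊆ false xs) q) refl
  everyOther-disjoint (_ ∷ u) (there p) q = everyOther-disjoint u q p

  length-everyOther : ∀ xs → length (everyOther false xs) ≡ ⌈ length xs /2⌉
                           × length (everyOther true xs) ≡ ⌊ length xs /2⌋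
  length-everyOther []       = refl , refl
  length-everyOther (x ∷ xs) with length-everyOther xs
  ... | even , odd = cong suc odd , even

  length-everyOther-double : ∀ b n xs → length xs ≡ n + n → length (everyOther b xs) ≡ n
  length-everyOther-double false n xs eq with length-everyOther xs
  ... | even , _ = trans even (trans (cong ⌈_/2⌉ eq) (sym (n≡⌈n+n/2⌉ n)))
  length-everyOther-double true  n xs eq with length-everyOther xs
  ... | _ , odd  = trans odd (trans (cong ⌊_/2⌋ eq) (sym (n≡⌊n+n/2⌋ n)))

  cell : BinSeq → List A → List A
  cell []      xs = xs
  cell (b ∷ σ) xs = cell σ (everyOther b xs)

  cell-⊆ : ∀ σ xs → cell σ xs ⊆ xs
  cell-⊆ []      xs = ⊆-refl
  cell-⊆ (b ∷ σ) xs = ⊆-trans (cell-⊆ σ (everyOther b xs)) (everyOther-⊆ b xs)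

  cell-++ : ∀ σ ρ xs → cell (σ ++ ρ) xs ≡ cell ρ (cell σ xs)
  cell-++ []      ρ xs = refl
  cell-++ (b ∷ σ) ρ xs = cell-++ σ ρ (everyOther b xs)

  cell-antitone : ∀ {σ τ} xs → σ ⊑ τ → cell τ xs ⊆ cell σ xs
  cell-antitone {σ} xs (ρ , refl) =
    subst (_⊆ cell σ xs) (sym (cell-++ σ ρ xs)) (cell-⊆ ρ (cell σ xs))

  Unique-cell : ∀ σ {xs} → Unique xs → Unique (cell σ xs)
  Unique-cell σ {xs} = AllPairs-resp-⊇ (cell-⊆ σ xs)

  ∈-cell : ∀ m {x xs} → x ∈ xs → ∃[ σ ] length σ ≡ m × x ∈ cell σ xs
  ∈-cell zero    x∈xs = [] , refl , x∈xs
  ∈-cell (suc m) x∈xs with ∈-everyOther x∈xs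
  ... | b , x∈half with ∈-cell m x∈half
  ...   | σ , refl , x∈cell = b ∷ σ , refl , x∈cell

  cell-disjoint : ∀ σ τ {xs} → Unique xs → length σ ≡ length τ → σ ≢ τ →
                  ∀ {x} → x ∈ cell σ xs → x ∉ cell τ xs
  cell-disjoint []          []          _ _  σ≢τ _ _ = σ≢τ refl
  cell-disjoint (false ∷ σ) (false ∷ τ) {xs} u eq σ≢τ =
    cell-disjoint σ τ (AllPairs-resp-⊇ (everyOther-⊆ false xs) u)
      (suc-injective eq) (σ≢τ ∘ cong (false ∷_))
  cell-disjoint (true  ∷ σ) (true  ∷ τ) {xs} u eq σ≢τ =
    cell-disjoint σ τ (AllPairs-resp-⊇ (everyOther-⊆ true xs) u)
      (suc-injective eq) (σ≢τ ∘ cong (true ∷_))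
  cell-disjoint (false ∷ σ) (true  ∷ τ) u _ _ p q =
    everyOther-disjoint u (Any-resp-⊆ (cell-⊆ σ _) p) (Any-resp-⊆ (cell-⊆ τ _) q)
  cell-disjoint (true  ∷ σ) (false ∷ τ) u _ _ p q =
    everyOther-disjoint u (Any-resp-⊆ (cell-⊆ τ _) q) (Any-resp-⊆ (cell-⊆ σ _) p)

  length-cell : ∀ σ l xs → length xs ≡ 2 ^ l → length σ ≤ l →
                length (cell σ xs) ≡ 2 ^ (l ∸ length σ)
  length-cell []      l       xs eq _         = eq
  length-cell (b ∷ σ) (suc l) xs eq (s≤s σ≤l) =
    length-cell σ l (everyOther b xs)
      (length-everyOther-double b (2 ^ l) xs (trans eq (2^[1+n]≡2^n+2^n l)))
      σ≤l

Spaced : ℕ → List ℕ → Set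
Spaced d = Linked (λ x y → d + x ≤ y)

Spaced-trans : ∀ {d x y z} → d + x ≤ y → d + y ≤ z → d + x ≤ z
Spaced-trans {d} {y = y} dx≤y dy≤z = ≤-trans dx≤y (≤-trans (m≤n+m y d) dy≤z)

Spaced-gap : ∀ {d xs x y} → Spaced d xs → x ∈ xs → y ∈ xs → x ≢ y → d ≤ ∣ x - y ∣
Spaced-gap {d} s = AllPairs-sym-∈ (λ {x} {y} g → subst (d ≤_) (∣-∣-comm x y) g)
  (AllPairs.map gap (Linked⇒AllPairs Spaced-trans s))
  where
  gap : ∀ {x y} → d + x ≤ y → d ≤ ∣ x - y ∣
  gap {x} {y} dx≤y =
    subst (d ≤_) (sym (m≤n⇒∣m-n∣≡n∸m (≤-trans (m≤n+m x d) dx≤y))) (m+n≤o⇒m≤o∸n d dx≤y)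

Spaced-everyOther : ∀ {d} b {xs} → Spaced d xs → Spaced (d + d) (everyOther b xs)
Spaced-everyOther false []                = []
Spaced-everyOther false [-]               = [-]
Spaced-everyOther false (_ ∷ [-])         = [-]
Spaced-everyOther false (dx≤y ∷ dy≤z ∷ s) = double-gap dx≤y dy≤z ∷ Spaced-everyOther false s
  where
  double-gap : ∀ {d x y z} → d + x ≤ y → d + y ≤ z → d + d + x ≤ z
  double-gap {d} {x} {z = z} dx≤y dy≤z =
    subst (_≤ z) (sym (+-assoc d d x)) (≤-trans (+-monoʳ-≤ d dx≤y) dy≤z)
Spaced-everyOther true  []                = []
Spaced-everyOther true  [-]               = []
Spaced-everyOther true  (_ ∷ s)           = Spaced-everyOther false s

Spaced-cell : ∀ {d} σ {xs} → Spaced d xs → Spaced (2 ^ length σ * d) (cell σ xs)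
Spaced-cell {d} []      {xs} s = subst (λ e → Spaced e xs) (sym (*-identityˡ d)) s
Spaced-cell {d} (b ∷ σ) {xs} s =
  subst (λ e → Spaced e (cell σ (everyOther b xs))) (doubling (2 ^ length σ) d)
    (Spaced-cell σ (Spaced-everyOther b s))
  where
  doubling : ∀ p d → p * (d + d) ≡ 2 * p * d
  doubling = solve-∀

GapExceeds-pow : ∀ n {g} → 2 ^ n ≤ g → GapExceeds n g
GapExceeds-pow zero    1≤g = 1≤g
GapExceeds-pow (suc n) {g} 2ⁿ⁺¹≤g =
  <-≤-trans (m<m+n (2 ^ n) (m^n>0 2 n)) (subst (_≤ g) (2^[1+n]≡2^n+2^n n) 2ⁿ⁺¹≤g)

strictly-sorted : ∀ {xs} → Linked _≤_ xs → Unique xs → Linked _<_ xs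
strictly-sorted sorted unique = Linked.zipWith (uncurry ≤∧≢⇒<) (sorted , AllPairs⇒Linked unique)

lemma2p3 : (l : ℕ) → 0 < l → (X : List ℕ) → Unique X → length X ≡ 2 ^ l →
    Σ (BinSeq → List ℕ) λ A →
      (∀ σ → length σ ≤ l → Unique (A σ) × (∀ {i} → i ∈ A σ → i ∈ X))
      × (∀ m → m ≤ l →
           (∀ {x} → x ∈ X → ∃ λ σ → length σ ≡ m × x ∈ A σ)
           × (∀ σ τ → length σ ≡ m → length τ ≡ m → σ ≢ τ →
                ∀ {x} → x ∈ A σ → ¬ (x ∈ A τ)))
      × (∀ σ → length σ ≤ l → length (A σ) ≡ 2 ^ (l ∸ length σ))
      × (∀ σ τ → length σ ≤ l → length τ ≤ l → σ ⊑ τ →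
           ∀ {i} → i ∈ A τ → i ∈ A σ)
      × (∀ σ → length σ ≤ l → ∀ {i j} → i ∈ A σ → j ∈ A σ → i ≢ j →
           GapExceeds (length σ) ∣ i - j ∣)
lemma2p3 l _ X uniqueX lengthX =
  (λ σ → cell σ S) ,
  (λ σ _ → Unique-cell σ uniqueS , ∈-resp-↭ (sort-↭ X) ∘ Any-resp-⊆ (cell-⊆ σ S)) ,
  (λ m _ → ∈-cell m ∘ ∈-resp-↭ (↭-sym (sort-↭ X)) ,
           λ σ τ |σ|≡m |τ|≡m → cell-disjoint σ τ uniqueS (trans |σ|≡m (sym |τ|≡m))) ,
  (λ σ → length-cell σ l S (trans (↭-length (sort-↭ X)) lengthX)) ,
  (λ σ τ _ _ σ⊑τ → Any-resp-⊆ (cell-antitone S σ⊑τ)) ,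
  (λ σ _ i∈ j∈ i≢j → GapExceeds-pow (length σ)
     (subst (_≤ _) (*-identityʳ (2 ^ length σ)) (Spaced-gap (Spaced-cell σ spacedS) i∈ j∈ i≢j)))
  where
  S : List ℕ
  S = sort X
  uniqueS : Unique S
  uniqueS = Unique-resp-↭ (setoid ℕ) (↭⇒↭ₛ (↭-sym (sort-↭ X))) uniqueX
  spacedS : Spaced 1 S
  spacedS = strictly-sorted (sort-↗ X) uniqueS
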